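{- Let $\mathcal{M}_n$ be a $2$-rigidity matroid on $\binom{[n]}{2}$. Then every $\mathcal{M}_n$-independent graph is $\mathcal{R}_n$-independent. Consequently, for any $2$-rigidity family $\mathcal{M}$, every $\mathcal{M}$-independent graph is $\mathcal{R}$-independent.
   Context: Graphs are identified with their edge sets; a graph on $[n]$ is a subset of $\binom{[n]}{2}$. A $2$-rigidity matroid is a matroid $\mathcal{M}_n$ on $\binom{[n]}{2}$ of rank $2n-3$ in which every copy of $K_4$ is a circuit. $\mathcal{R}_n$: $G\subseteq\binom{[n]}{2}$ is $\mathcal{R}_n$-independent iff every set of $m$ vertices, $2\le m\le n$, induces at most $2m-3$ edges of $G$; $\mathcal{R}=(\mathcal{R}_n)_{n\ge2}$. A matroidal family is a sequence $(\mathcal{M}_n)$ of graph matroids, each invariant under vertex relabelling, such that a graph $\mathcal{M}_n$-independent for some $n$ is $\mathcal{M}_n$-independent for all $n\ge v(G)$; a $2$-rigidity family is a matroidal family with each $\mathcal{M}_n$ of rank $2n-3$; "$G$ is $\mathcal{M}$-independent" means $\mathcal{M}_n$-independent for $n\ge v(G)$. -}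

module Defs where

open import Data.Nat using (ℕ; _≤_; _<_; _∸_; _*_; _<ᵇ_)
open import Data.Bool using (Bool; true; false; _∧_; _∨_; not; if_then_else_)
open import Data.Fin using (Fin; toℕ; inject≤; _≟_)
open import Data.Fin.Subset using (Subset; ∣_∣)
open import Data.Vec using (lookup)
open import Data.List using (List; length; filterᵇ; allFin; concatMap; map)
open import Data.Product using (Σ; ∃; _×_; _,_; proj₁; proj₂)
open import Data.Empty using (⊥)
open import Relation.Nullary using (¬_)
open import Relation.Nullary.Decidable using (⌊_⌋)
open import Relation.Binary.PropositionalEquality using (_≡_; _≢_)
open import Data.Fin.Permutation using (Permutation′; _⟨$⟩ʳ_)

-- Graphs on [n] = Fin n.  A graph is a Boolean function G; its edge set
-- is { {i,j} : toℕ i < toℕ j , G i j ≡ true }  ⊆  (Fin n choose 2).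
-- Entries with i ≥ j are irrelevant (never consulted).

Graph : ℕ → Set
Graph n = Fin n → Fin n → Bool

_<F_ : ∀ {n} → Fin n → Fin n → Set
i <F j = toℕ i < toℕ j

pairs : (n : ℕ) → List (Fin n × Fin n)
pairs n = filterᵇ (λ p → toℕ (proj₁ p) <ᵇ toℕ (proj₂ p))
                  (concatMap (λ i → map (λ j → (i , j)) (allFin n)) (allFin n))

size : ∀ {n} → Graph n → ℕ
size {n} G = length (filterᵇ (λ p → G (proj₁ p) (proj₂ p)) (pairs n))

_≈G_ : ∀ {n} → Graph n → Graph n → Set
G ≈G H = ∀ i j → i <F j → G i j ≡ H i j

_⊆G_ : ∀ {n} → Graph n → Graph n → Set
G ⊆G H = ∀ i j → i <F j → G i j ≡ true → H i j ≡ true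

emptyG : ∀ {n} → Graph n
emptyG _ _ = false

addEdge : ∀ {n} → Graph n → Fin n → Fin n → Graph n
addEdge G i j a b = G a b ∨ (⌊ a ≟ i ⌋ ∧ ⌊ b ≟ j ⌋)

record Matroid (n : ℕ) : Set₁ where
  field
    Ind     : Graph n → Set
    ind-ext : ∀ {G H} → G ≈G H → Ind G → Ind H
    ind-∅   : Ind emptyG
    ind-sub : ∀ {G H} → H ⊆G G → Ind G → Ind H
    ind-aug : ∀ {A B} → Ind A → Ind B → size A < size B →
              Σ (Fin n) λ i → Σ (Fin n) λ j →
                i <F j × B i j ≡ true × A i j ≡ false × Ind (addEdge A i j)
open Matroid public

HasRank : ∀ {n} → Matroid n → ℕ → Set
HasRank M r = (Σ (Graph _) λ G → Ind M G × size G ≡ r)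
            × (∀ G → Ind M G → size G ≤ r)

IsCircuit : ∀ {n} → Matroid n → Graph n → Set
IsCircuit M C = ¬ Ind M C × (∀ D → D ⊆G C → ¬ (C ⊆G D) → Ind M D)

K4 : ∀ {n} → Fin n → Fin n → Fin n → Fin n → Graph n
K4 a b c d i j = inQ i ∧ inQ j ∧ not ⌊ i ≟ j ⌋
  where
  inQ : _ → Bool
  inQ x = ⌊ x ≟ a ⌋ ∨ ⌊ x ≟ b ⌋ ∨ ⌊ x ≟ c ⌋ ∨ ⌊ x ≟ d ⌋

record Is2RigidityMatroid {n : ℕ} (M : Matroid n) : Set where
  field
    rank   : HasRank M (2 * n ∸ 3)
    K4circ : ∀ a b c d → a ≢ b → a ≢ c → a ≢ d → b ≢ c → b ≢ d → c ≢ d →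
             IsCircuit M (K4 a b c d)

induced : ∀ {n} → Graph n → Subset n → Graph n
induced G S i j = G i j ∧ lookup S i ∧ lookup S j

R-Ind : ∀ {n} → Graph n → Set
R-Ind G = ∀ S → 2 ≤ ∣ S ∣ → size (induced G S) ≤ 2 * ∣ S ∣ ∸ 3

adj : ∀ {n} → Graph n → Fin n → Fin n → Bool
adj G a b = if toℕ a <ᵇ toℕ b then G a b else G b a

relabel : ∀ {n} → Permutation′ n → Graph n → Graph n
relabel σ G i j = adj G (σ ⟨$⟩ʳ i) (σ ⟨$⟩ʳ j)

restrict : ∀ {n n'} → n ≤ n' → Graph n' → Graph n
restrict le G i j = G (inject≤ i le) (inject≤ j le)

SupportedIn : ∀ {n'} → ℕ → Graph n' → Set
SupportedIn n G = ∀ i j → i <F j → G i j ≡ true → toℕ j < n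

record MatroidalFamily : Set₁ where
  field
    M : (n : ℕ) → Matroid n
    relabel-inv : ∀ {n} (σ : Permutation′ n) (G : Graph n) →
                  (Ind (M n) G → Ind (M n) (relabel σ G)) ×
                  (Ind (M n) (relabel σ G) → Ind (M n) G)
    consistent : ∀ {n n'} (le : n ≤ n') (G : Graph n') → SupportedIn n G →
                 (Ind (M n') G → Ind (M n) (restrict le G)) ×
                 (Ind (M n) (restrict le G) → Ind (M n') G)

record Is2RigidityFamily (F : MatroidalFamily) : Set where
  field
    rank2 : ∀ n → 2 ≤ n → HasRank (MatroidalFamily.M F n) (2 * n ∸ 3)

{-# OPTIONS --safe #-}
module Submission where

-- Fix a vertex set S with |S| = m ≥ 2 and two of its vertices a, b.  The 2m − 3 edges ab, ax, bx
-- (x ∈ S ∖ {a, b}) span the complete graph on S: an edge xy is spanned by the other five edges of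
-- the K4 on {x, y, a, b}, because that K4 is a circuit.  So no independent set of edges inside S
-- has more than 2m − 3 elements, which is R-independence.  Since Ind is not decidable, the
-- spanning set is only obtained under double negation; this is harmless because the inequality
-- to be proved is decidable.
-- In a 2-rigidity family, M 4 has rank 5, so the complete graph on four vertices is dependent and
-- a basis of M 4 is that graph minus one edge.  Relabelling and consistency transport this to every
-- K4 of every M n, so K4s are circuits there as well.

open import Defs
open import Data.Bool using (Bool; true; false; _∧_; _∨_; not; T)
import Data.Bool as Bool
open import Data.Bool.Properties using (∨-zeroʳ; ∨-comm; ∧-comm; ∧-zeroʳ)
open import Data.Empty using (⊥; ⊥-elim)
open import Data.Fin using (Fin; zero; suc; toℕ; _≟_; inject≤; punchIn; punchOut)
open import Data.Fin.Patterns using (0F; 1F; 2F; 3F)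
open import Data.Fin.Permutation
  using (Permutation; Permutation′; _⟨$⟩ʳ_; _⟨$⟩ˡ_; inverseˡ; insert; insert-punchIn) renaming (id to idₚ)
open import Data.Fin.Properties
  using (<-cmp; <-irrefl; <-asym; <⇒≢; suc-injective; punchOut-injective; punchIn-punchOut;
         inject≤-injective; toℕ-inject≤; toℕ<n; injective⇒≤)
open import Data.Fin.Subset using (Subset; ∣_∣)
open import Data.List using (List; []; _∷_; length; filterᵇ; allFin; concatMap; map; cartesianProduct; _++_; tabulate)
open import Data.List.Membership.Propositional using (_∈_; lose; find)
open import Data.List.Membership.Propositional.Properties using (∈-filter⁺; ∈-concatMap⁺; ∈-map⁺; ∈-allFin)
open import Data.List.Properties using (filter-none; length-++; length-map)
open import Data.List.Relation.Unary.All as All using (All; []; _∷_)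
open import Data.List.Relation.Unary.All.Properties using (all-filter; ¬Any⇒All¬; ++⁻; map⁻)
open import Data.List.Relation.Unary.AllPairs using ([]; _∷_)
open import Data.List.Relation.Unary.Any using (Any; here; there; any?)
open import Data.List.Relation.Unary.Unique.Propositional using (Unique)
import Data.List.Relation.Unary.Unique.Propositional.Properties as Unique
open import Data.Nat using (ℕ; zero; suc; _+_; _*_; _∸_; _≤_; _<_; z≤n; s≤s; s≤s⁻¹; _≤?_; _<ᵇ_)
open import Data.Nat.Properties
  using (≤-trans; ≤-reflexive; <-≤-trans; 1+n≰n; m≤n⇒m≤1+n; n≤1+n; m≤m+n; +-suc; +-identityʳ;
         *-distribˡ-+; +-monoʳ-≤; ≰⇒>; <⇒≱; <ᵇ⇒<; <⇒<ᵇ)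
open import Data.Product using (Σ-syntax; _×_; _,_; proj₁; proj₂; uncurry)
open import Data.Sum using (_⊎_; inj₁; inj₂)
open import Data.Unit using (tt)
open import Data.Vec using (lookup) renaming ([] to []ᵛ; _∷_ to _∷ᵛ_)
open import Data.Vec.Relation.Unary.All using ([]; _∷_)
open import Data.Vec.Relation.Unary.AllPairs using ([]; _∷_)
open import Data.Vec.Relation.Unary.Unique.Propositional.Properties using (lookup-injective)
open import Effect.Monad using (RawMonad)
open import Function using (_∘_; id)
open import Function.Definitions using (Injective)
open import Level using (0ℓ)
open import Relation.Binary using (tri<; tri≈; tri>)
open import Relation.Binary.PropositionalEquality
  using (_≡_; _≢_; refl; sym; trans; cong; cong₂; subst; subst₂; ≢-sym)
open import Relation.Nullary using (¬_; Dec; yes; no; contradiction)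
open import Relation.Nullary.Decidable using (⌊_⌋; T?; _×-dec_; decidable-stable; ¬¬-excluded-middle)
open import Relation.Nullary.Negation using (¬¬-Monad)

∧-true⁻ : ∀ {a b} → a ∧ b ≡ true → a ≡ true × b ≡ true
∧-true⁻ {true} b≡true = refl , b≡true

∨-true⁻ : ∀ {a b} → a ∨ b ≡ true → a ≡ true ⊎ b ≡ true
∨-true⁻ {true}  _      = inj₁ refl
∨-true⁻ {false} b≡true = inj₂ b≡true

∨-introˡ : ∀ {a} b → a ≡ true → a ∨ b ≡ true
∨-introˡ _ refl = refl

∨-introʳ : ∀ a {b} → b ≡ true → a ∨ b ≡ true
∨-introʳ a refl = ∨-zeroʳ a

∧-swapˡ : ∀ p q r → p ∧ q ∧ r ≡ q ∧ p ∧ r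
∧-swapˡ true  q     r = refl
∧-swapˡ false true  r = refl
∧-swapˡ false false r = refl

≡false⇒¬≡true : {b : Bool} → b ≡ false → ¬ b ≡ true
≡false⇒¬≡true refl ()

module _ {n : ℕ} where

  ≟-refl : (i : Fin n) → ⌊ i ≟ i ⌋ ≡ true
  ≟-refl i with i ≟ i
  ... | yes _  = refl
  ... | no i≢i = contradiction refl i≢i

  ≟-false : {i j : Fin n} → i ≢ j → ⌊ i ≟ j ⌋ ≡ false
  ≟-false {i} {j} i≢j with i ≟ j
  ... | yes i≡j = contradiction i≡j i≢j
  ... | no _    = refl

  ≟-true⁻ : {i j : Fin n} → ⌊ i ≟ j ⌋ ≡ true → i ≡ j
  ≟-true⁻ {i} {j} eq with i ≟ j | eq
  ... | yes i≡j | _ = i≡j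
  ... | no _    | ()

  ≟-sym : (i j : Fin n) → ⌊ i ≟ j ⌋ ≡ ⌊ j ≟ i ⌋
  ≟-sym i j with i ≟ j | j ≟ i
  ... | yes _   | yes _   = refl
  ... | no _    | no _    = refl
  ... | yes i≡j | no j≢i  = contradiction (sym i≡j) j≢i
  ... | no i≢j  | yes j≡i = contradiction (sym j≡i) i≢j

module _ {m n : ℕ} {φ : Fin m → Fin n} (φ-inj : Injective _≡_ _≡_ φ) where

  ≟-∘ : (i j : Fin m) → ⌊ φ i ≟ φ j ⌋ ≡ ⌊ i ≟ j ⌋
  ≟-∘ i j with i ≟ j | φ i ≟ φ j
  ... | yes refl | yes _     = refl
  ... | yes refl | no φi≢φi  = contradiction refl φi≢φi
  ... | no i≢j   | yes φi≡φj = contradiction (φ-inj φi≡φj) i≢j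
  ... | no _     | no _      = refl

module _ {A : Set} where

  length-filterᵇ-mono : {p q : A → Bool} (xs : List A) → All (λ x → p x ≡ true → q x ≡ true) xs →
                        length (filterᵇ p xs) ≤ length (filterᵇ q xs)
  length-filterᵇ-mono [] [] = z≤n
  length-filterᵇ-mono {p} {q} (x ∷ xs) (p⇒q ∷ ps) with p x | q x | p⇒q
  ... | true  | true  | _ = s≤s (length-filterᵇ-mono xs ps)
  ... | true  | false | h with () ← h refl
  ... | false | true  | _ = m≤n⇒m≤1+n (length-filterᵇ-mono xs ps)
  ... | false | false | _ = length-filterᵇ-mono xs ps

  length-filterᵇ-< : {p q : A → Bool} (xs : List A) → All (λ x → p x ≡ true → q x ≡ true) xs →
                     Any (λ x → p x ≡ false × q x ≡ true) xs → length (filterᵇ p xs) < length (filterᵇ q xs)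
  length-filterᵇ-< (x ∷ xs) (_ ∷ ps) (here (px , qx)) rewrite px | qx = s≤s (length-filterᵇ-mono xs ps)
  length-filterᵇ-< {p} {q} (x ∷ xs) (p⇒q ∷ ps) (there any) with p x | q x | p⇒q
  ... | true  | true  | _ = s≤s (length-filterᵇ-< xs ps any)
  ... | true  | false | h with () ← h refl
  ... | false | true  | _ = m≤n⇒m≤1+n (length-filterᵇ-< xs ps any)
  ... | false | false | _ = length-filterᵇ-< xs ps any

  length-filterᵇ-∨ : {p e : A → Bool} {y : A} (xs : List A) → Unique xs → (∀ x → e x ≡ true → x ≡ y) →
                     length (filterᵇ (λ x → p x ∨ e x) xs) ≤ suc (length (filterᵇ p xs))
  length-filterᵇ-∨ [] [] _ = z≤n
  length-filterᵇ-∨ {p} {e} (x ∷ xs) (x∉xs ∷ u) e⇒y with p x | e x in ex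
  ... | true  | _     = s≤s (length-filterᵇ-∨ xs u e⇒y)
  ... | false | false = length-filterᵇ-∨ xs u e⇒y
  ... | false | true  = s≤s (length-filterᵇ-mono xs (All.map drop-e x∉xs))
    where
    drop-e : ∀ {z} → x ≢ z → p z ∨ e z ≡ true → p z ≡ true
    drop-e {z} x≢z pe with p z | e z in ez
    ... | true  | _    = refl
    ... | false | true = contradiction (trans (e⇒y x ex) (sym (e⇒y z ez))) x≢z

length-filterᵇ-tabulate : {n : ℕ} {A : Set} (S : Subset n) (h : Fin n → A) (p : A → Bool) →
                          (∀ i → p (h i) ≡ lookup S i) → length (filterᵇ p (tabulate h)) ≡ ∣ S ∣
length-filterᵇ-tabulate []ᵛ      h p ph≡S = refl
length-filterᵇ-tabulate (s ∷ᵛ S) h p ph≡S rewrite ph≡S zero with s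
... | true  = cong suc (length-filterᵇ-tabulate S (h ∘ suc) p (ph≡S ∘ suc))
... | false = length-filterᵇ-tabulate S (h ∘ suc) p (ph≡S ∘ suc)

module _ {n : ℕ} where

  private
    ordered : Fin n × Fin n → Bool
    ordered p = toℕ (proj₁ p) <ᵇ toℕ (proj₂ p)

    allPairs : List (Fin n × Fin n)
    allPairs = concatMap (λ i → map (λ j → (i , j)) (allFin n)) (allFin n)

  concatMap≡cartesianProduct : (xs ys : List (Fin n)) →
                               concatMap (λ i → map (λ j → (i , j)) ys) xs ≡ cartesianProduct xs ys
  concatMap≡cartesianProduct []       ys = refl
  concatMap≡cartesianProduct (x ∷ xs) ys = cong (map (λ j → (x , j)) ys ++_) (concatMap≡cartesianProduct xs ys)

  pairs-unique : Unique (pairs n)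
  pairs-unique = Unique.filter⁺ (T? ∘ ordered)
    (subst Unique (sym (concatMap≡cartesianProduct (allFin n) (allFin n)))
           (Unique.cartesianProduct⁺ (Unique.allFin⁺ n) (Unique.allFin⁺ n)))

  pairs-< : All (λ p → proj₁ p <F proj₂ p) (pairs n)
  pairs-< = All.map (λ {p} → <ᵇ⇒< (toℕ (proj₁ p)) (toℕ (proj₂ p))) (all-filter (T? ∘ ordered) allPairs)

  ∈-pairs : {i j : Fin n} → i <F j → (i , j) ∈ pairs n
  ∈-pairs {i} {j} i<j = ∈-filter⁺ (T? ∘ ordered)
    (∈-concatMap⁺ (λ i → map (λ j → (i , j)) (allFin n)) (lose (∈-allFin i) (∈-map⁺ (λ j → (i , j)) (∈-allFin j))))
    (<⇒<ᵇ i<j)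

  size-< : {G H : Graph n} {i j : Fin n} → G ⊆G H → i <F j → G i j ≡ false → H i j ≡ true → size G < size H
  size-< G⊆H i<j Gij Hij =
    length-filterᵇ-< (pairs n) (All.map (λ {p} → G⊆H (proj₁ p) (proj₂ p)) pairs-<) (lose (∈-pairs i<j) (Gij , Hij))

  size-addEdge : (G : Graph n) (i j : Fin n) → size (addEdge G i j) ≤ suc (size G)
  size-addEdge G i j = length-filterᵇ-∨ (pairs n) pairs-unique λ (a , b) ab≡ij →
    let a≡i , b≡j = ∧-true⁻ ab≡ij in cong₂ _,_ (≟-true⁻ a≡i) (≟-true⁻ b≡j)

  size-emptyG : size (emptyG {n}) ≡ 0
  size-emptyG = cong length (filter-none (T? ∘ λ _ → false) (All.universal (λ _ ()) (pairs n)))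

  size-≤⇒⊇ : {G H : Graph n} → G ⊆G H → size H ≤ size G → H ⊆G G
  size-≤⇒⊇ {G} G⊆H H≤G i j i<j Hij with G i j in Gij
  ... | true  = refl
  ... | false = contradiction H≤G (<⇒≱ (size-< G⊆H i<j Gij Hij))

  missing-edge : {G H : Graph n} → size G < size H →
                 Σ[ (i , j) ∈ Fin n × Fin n ] i <F j × H i j ≡ true × G i j ≡ false
  missing-edge {G} {H} G<H with any? (λ (i , j) → H i j Bool.≟ true ×-dec G i j Bool.≟ false) (pairs n)
  ... | yes found = let ij , ij∈ , Hij , Gij = find found in ij , All.lookup pairs-< ij∈ , Hij , Gij
  ... | no none   = contradiction (length-filterᵇ-mono (pairs n) (All.map H⇒G (¬Any⇒All¬ (pairs n) none))) (<⇒≱ G<H)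
    where
    H⇒G : {p : Fin n × Fin n} → ¬ (H (proj₁ p) (proj₂ p) ≡ true × G (proj₁ p) (proj₂ p) ≡ false) →
          H (proj₁ p) (proj₂ p) ≡ true → G (proj₁ p) (proj₂ p) ≡ true
    H⇒G {i , j} ¬HG Hij with G i j
    ... | true  = refl
    ... | false = contradiction (Hij , refl) ¬HG

module _ {n : ℕ} where

  ⊆G-refl : {G : Graph n} → G ⊆G G
  ⊆G-refl _ _ _ Gij = Gij

  ⊆G-trans : {F G H : Graph n} → F ⊆G G → G ⊆G H → F ⊆G H
  ⊆G-trans F⊆G G⊆H i j i<j = G⊆H i j i<j ∘ F⊆G i j i<j

  addEdge-edge : (G : Graph n) (i j : Fin n) → addEdge G i j i j ≡ true
  addEdge-edge G i j rewrite ≟-refl i | ≟-refl j = ∨-zeroʳ (G i j)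

  addEdge⁻ : {G : Graph n} {i j a b : Fin n} → addEdge G i j a b ≡ true → G a b ≡ true ⊎ (a ≡ i × b ≡ j)
  addEdge⁻ {G} {a = a} {b} e with ∨-true⁻ {G a b} e
  ... | inj₁ Gab   = inj₁ Gab
  ... | inj₂ ab≡ij = let a≡i , b≡j = ∧-true⁻ ab≡ij in inj₂ (≟-true⁻ a≡i , ≟-true⁻ b≡j)

  ⊆-addEdge : {G : Graph n} {i j : Fin n} → G ⊆G addEdge G i j
  ⊆-addEdge _ _ _ Gab = ∨-introˡ _ Gab

  addEdge-⊆ : {G H : Graph n} {i j : Fin n} → G ⊆G H → H i j ≡ true → addEdge G i j ⊆G H
  addEdge-⊆ {G} G⊆H Hij a b a<b e with addEdge⁻ {G} e
  ... | inj₁ Gab           = G⊆H a b a<b Gab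
  ... | inj₂ (refl , refl) = Hij

  addEdge-mono : {G H : Graph n} {i j : Fin n} → G ⊆G H → addEdge G i j ⊆G addEdge H i j
  addEdge-mono {H = H} {i} {j} G⊆H = addEdge-⊆ (⊆G-trans G⊆H ⊆-addEdge) (addEdge-edge H i j)

  _∪G_ : Graph n → Graph n → Graph n
  (G ∪G H) i j = G i j ∨ H i j

  ∪G-addEdge : {G H : Graph n} {i j : Fin n} → H i j ≡ true → (addEdge G i j ∪G H) ⊆G (G ∪G H)
  ∪G-addEdge {G} {H} Hij a b _ e with ∨-true⁻ {addEdge G _ _ a b} e
  ... | inj₂ Hab = ∨-introʳ (G a b) Hab
  ... | inj₁ G+ab with addEdge⁻ {G = G} G+ab
  ...   | inj₁ Gab           = ∨-introˡ (H a b) Gab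
  ...   | inj₂ (refl , refl) = ∨-introʳ (G a b) Hij

  isEdge : Fin n → Fin n → Fin n → Fin n → Bool
  isEdge a b i j = ⌊ i ≟ a ⌋ ∧ ⌊ j ≟ b ⌋ ∨ ⌊ i ≟ b ⌋ ∧ ⌊ j ≟ a ⌋

  isEdge-refl : (a b : Fin n) → isEdge a b a b ≡ true
  isEdge-refl a b rewrite ≟-refl a | ≟-refl b = refl

  isEdge-swap : (a b : Fin n) → isEdge a b b a ≡ true
  isEdge-swap a b rewrite ≟-refl a | ≟-refl b = ∨-zeroʳ _

  isEdge⁻ : {a b i j : Fin n} → a <F b → i <F j → isEdge a b i j ≡ true → i ≡ a × j ≡ b
  isEdge⁻ {a} {b} {i} {j} a<b i<j e with ∨-true⁻ {⌊ i ≟ a ⌋ ∧ ⌊ j ≟ b ⌋} e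
  ... | inj₁ ij≡ab = let i≡a , j≡b = ∧-true⁻ ij≡ab in ≟-true⁻ i≡a , ≟-true⁻ j≡b
  ... | inj₂ ij≡ba with ∧-true⁻ {⌊ i ≟ b ⌋} ij≡ba
  ...   | i≡b , j≡a with ≟-true⁻ i≡b | ≟-true⁻ j≡a
  ...     | refl | refl = contradiction a<b (<-asym i<j)

  deleteEdge : Graph n → Fin n → Fin n → Graph n
  deleteEdge G a b i j = G i j ∧ not (isEdge a b i j)

  deleteEdge⁻ : {G : Graph n} {a b i j : Fin n} → deleteEdge G a b i j ≡ true → G i j ≡ true × isEdge a b i j ≡ false
  deleteEdge⁻ {G} {a} {b} {i} {j} e with G i j | isEdge a b i j | e
  ... | true | false | _ = refl , refl

  deleteEdge-⊆ : {G : Graph n} {a b : Fin n} → deleteEdge G a b ⊆G G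
  deleteEdge-⊆ {G} _ _ _ e = proj₁ (deleteEdge⁻ {G} e)

  deleteEdge-edge : (G : Graph n) (a b : Fin n) → deleteEdge G a b a b ≡ false
  deleteEdge-edge G a b = trans (cong (λ e → G a b ∧ not e) (isEdge-refl a b)) (∧-zeroʳ (G a b))

  deleteEdge-swap : (G : Graph n) (a b : Fin n) → deleteEdge G a b b a ≡ false
  deleteEdge-swap G a b = trans (cong (λ e → G b a ∧ not e) (isEdge-swap a b)) (∧-zeroʳ (G b a))

  ⊆-deleteEdge : {G H : Graph n} {a b : Fin n} → G ⊆G H → a <F b → G a b ≡ false → G ⊆G deleteEdge H a b
  ⊆-deleteEdge {G} {H} {a} {b} G⊆H a<b Gab i j i<j Gij with isEdge a b i j in e
  ... | false rewrite G⊆H i j i<j Gij = refl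
  ... | true with isEdge⁻ a<b i<j e
  ...   | refl , refl = contradiction Gij (≡false⇒¬≡true Gab)

  ⊆-addEdge-deleteEdge : {G : Graph n} {a b : Fin n} → a <F b → G ⊆G addEdge (deleteEdge G a b) a b
  ⊆-addEdge-deleteEdge {G} {a} {b} a<b i j i<j Gij with isEdge a b i j in e
  ... | false rewrite Gij = refl
  ... | true with isEdge⁻ a<b i<j e
  ...   | refl , refl rewrite ≟-refl a | ≟-refl b = ∨-zeroʳ _

  oneOf : Fin n → Fin n → Fin n → Fin n → Fin n → Bool
  oneOf a b c d x = ⌊ x ≟ a ⌋ ∨ ⌊ x ≟ b ⌋ ∨ ⌊ x ≟ c ⌋ ∨ ⌊ x ≟ d ⌋

  oneOf⁻ : {a b c d x : Fin n} → oneOf a b c d x ≡ true → x ∈ a ∷ b ∷ c ∷ d ∷ []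
  oneOf⁻ {a} {b} {c} {d} {x} e with ∨-true⁻ {⌊ x ≟ a ⌋} e
  ... | inj₁ x≡a = here (≟-true⁻ x≡a)
  ... | inj₂ e with ∨-true⁻ {⌊ x ≟ b ⌋} e
  ...   | inj₁ x≡b = there (here (≟-true⁻ x≡b))
  ...   | inj₂ e with ∨-true⁻ {⌊ x ≟ c ⌋} e
  ...     | inj₁ x≡c = there (there (here (≟-true⁻ x≡c)))
  ...     | inj₂ x≡d = there (there (there (here (≟-true⁻ x≡d))))

  oneOf⁺ : {a b c d x : Fin n} → x ∈ a ∷ b ∷ c ∷ d ∷ [] → oneOf a b c d x ≡ true
  oneOf⁺ {a} (here refl) = ∨-introˡ _ (≟-refl a)
  oneOf⁺ {a} {b} {x = x} (there (here refl)) = ∨-introʳ ⌊ x ≟ a ⌋ (∨-introˡ _ (≟-refl b))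
  oneOf⁺ {a} {b} {c} {x = x} (there (there (here refl))) =
    ∨-introʳ ⌊ x ≟ a ⌋ (∨-introʳ ⌊ x ≟ b ⌋ (∨-introˡ _ (≟-refl c)))
  oneOf⁺ {a} {b} {c} {d} {x} (there (there (there (here refl)))) =
    ∨-introʳ ⌊ x ≟ a ⌋ (∨-introʳ ⌊ x ≟ b ⌋ (∨-introʳ ⌊ x ≟ c ⌋ (≟-refl d)))

  K4⁻ : {a b c d i j : Fin n} → K4 a b c d i j ≡ true → i ∈ a ∷ b ∷ c ∷ d ∷ [] × j ∈ a ∷ b ∷ c ∷ d ∷ []
  K4⁻ {a} {b} {c} {d} {i} e =
    let i∈ , rest = ∧-true⁻ {oneOf a b c d i} e in oneOf⁻ i∈ , oneOf⁻ (proj₁ (∧-true⁻ rest))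

  K4⁺ : {a b c d i j : Fin n} → i ∈ a ∷ b ∷ c ∷ d ∷ [] → j ∈ a ∷ b ∷ c ∷ d ∷ [] → i ≢ j → K4 a b c d i j ≡ true
  K4⁺ {i = i} {j} i∈ j∈ i≢j =
    trans (cong₂ (λ p q → p ∧ q ∧ not ⌊ i ≟ j ⌋) (oneOf⁺ i∈) (oneOf⁺ j∈)) (cong not (≟-false i≢j))

  K4-minus : Fin n → Fin n → Fin n → Fin n → Graph n
  K4-minus a b c d = deleteEdge (K4 a b c d) a b

  K4⊈K4-minus : {a b c d : Fin n} → a ≢ b → ¬ (K4 a b c d ⊆G K4-minus a b c d)
  K4⊈K4-minus {a} {b} {c} {d} a≢b K4⊆ with <-cmp a b
  ... | tri< a<b _ _ = ≡false⇒¬≡true (deleteEdge-edge (K4 a b c d) a b)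
                         (K4⊆ a b a<b (K4⁺ (here refl) (there (here refl)) a≢b))
  ... | tri≈ _ a≡b _ = a≢b a≡b
  ... | tri> _ _ b<a = ≡false⇒¬≡true (deleteEdge-swap (K4 a b c d) a b)
                         (K4⊆ b a b<a (K4⁺ (there (here refl)) (here refl) (≢-sym a≢b)))

  IsSymmetric : Graph n → Set
  IsSymmetric G = ∀ i j → G i j ≡ G j i

  adj-symmetric : {G : Graph n} → IsSymmetric G → ∀ i j → adj G i j ≡ G i j
  adj-symmetric {G} G-sym i j with toℕ i <ᵇ toℕ j
  ... | true  = refl
  ... | false = G-sym j i

  K4-symmetric : (a b c d : Fin n) → IsSymmetric (K4 a b c d)
  K4-symmetric a b c d i j =
    trans (∧-swapˡ (oneOf a b c d i) (oneOf a b c d j) _)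
          (cong (λ e → oneOf a b c d j ∧ oneOf a b c d i ∧ not e) (≟-sym i j))

  deleteEdge-symmetric : {G : Graph n} → IsSymmetric G → (a b : Fin n) → IsSymmetric (deleteEdge G a b)
  deleteEdge-symmetric G-sym a b i j =
    cong₂ (λ g e → g ∧ not e) (G-sym i j)
          (trans (∨-comm (⌊ i ≟ a ⌋ ∧ ⌊ j ≟ b ⌋) _) (cong₂ _∨_ (∧-comm ⌊ i ≟ b ⌋ _) (∧-comm ⌊ i ≟ a ⌋ _)))

module _ {m n : ℕ} {φ : Fin m → Fin n} (φ-inj : Injective _≡_ _≡_ φ) where

  oneOf-∘ : (a b c d x : Fin m) → oneOf (φ a) (φ b) (φ c) (φ d) (φ x) ≡ oneOf a b c d x
  oneOf-∘ a b c d x =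
    cong₂ _∨_ (≟-∘ φ-inj x a) (cong₂ _∨_ (≟-∘ φ-inj x b) (cong₂ _∨_ (≟-∘ φ-inj x c) (≟-∘ φ-inj x d)))

  K4-∘ : (a b c d i j : Fin m) → K4 (φ a) (φ b) (φ c) (φ d) (φ i) (φ j) ≡ K4 a b c d i j
  K4-∘ a b c d i j =
    cong₂ _∧_ (oneOf-∘ a b c d i) (cong₂ _∧_ (oneOf-∘ a b c d j) (cong not (≟-∘ φ-inj i j)))

  isEdge-∘ : (a b i j : Fin m) → isEdge (φ a) (φ b) (φ i) (φ j) ≡ isEdge a b i j
  isEdge-∘ a b i j =
    cong₂ _∨_ (cong₂ _∧_ (≟-∘ φ-inj i a) (≟-∘ φ-inj j b)) (cong₂ _∧_ (≟-∘ φ-inj i b) (≟-∘ φ-inj j a))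

  K4-minus-∘ : (a b c d i j : Fin m) → K4-minus (φ a) (φ b) (φ c) (φ d) (φ i) (φ j) ≡ K4-minus a b c d i j
  K4-minus-∘ a b c d i j = cong₂ _∧_ (K4-∘ a b c d i j) (cong not (isEdge-∘ a b i j))

-- Closure in a matroid

module MatroidClosure {n : ℕ} (M : Matroid n) where

  open RawMonad (¬¬-Monad {0ℓ}) using (return; _>>=_)

  InClosure : Graph n → Fin n → Fin n → Set
  InClosure A i j = A i j ≡ true ⊎ ¬ Ind M (addEdge A i j)

  Spans : Graph n → Graph n → Set
  Spans A X = ∀ i j → i <F j → X i j ≡ true → InClosure A i j

  InClosure-mono : {A B : Graph n} {i j : Fin n} → A ⊆G B → i <F j → InClosure A i j → InClosure B i j
  InClosure-mono A⊆B i<j (inj₁ Aij)   = inj₁ (A⊆B _ _ i<j Aij)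
  InClosure-mono A⊆B i<j (inj₂ A+dep) = inj₂ (A+dep ∘ ind-sub M (addEdge-mono A⊆B))

  ∉-closure : {A : Graph n} {i j : Fin n} → A i j ≡ false → Ind M (addEdge A i j) → ¬ InClosure A i j
  ∉-closure Aij iA+ (inj₁ Aij′)  = ≡false⇒¬≡true Aij Aij′
  ∉-closure Aij iA+ (inj₂ A+dep) = A+dep iA+

  spans-size : {A X I : Graph n} → Ind M A → Spans A X → Ind M I → I ⊆G X → size I ≤ size A
  spans-size {A} {I = I} iA A↝X iI I⊆X with size I ≤? size A
  ... | yes I≤A = I≤A
  ... | no I≰A with ind-aug M iA iI (≰⇒> I≰A)
  ...   | i , j , i<j , Iij , Aij , iA+ = ⊥-elim (∉-closure Aij iA+ (A↝X i j i<j (I⊆X i j i<j Iij)))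

  augment-until : (k : ℕ) {D B : Graph n} → Ind M D → Ind M B → size B ≤ k + size D →
                  Σ[ E ∈ Graph n ] Ind M E × D ⊆G E × E ⊆G (D ∪G B) × size B ≤ size E
  augment-until k {D} {B} iD iB bound with size B ≤? size D
  ... | yes B≤D = D , iD , ⊆G-refl , (λ a b _ Dab → ∨-introˡ (B a b) Dab) , B≤D
  augment-until zero    iD iB bound | no B≰D = contradiction bound B≰D
  augment-until (suc k) {D} {B} iD iB bound | no B≰D with ind-aug M iD iB (≰⇒> B≰D)
  ... | i , j , i<j , Bij , Dij , iD+ =
    let E , iE , D+⊆E , E⊆ , B≤E = augment-until k iD+ iB bound′
    in  E , iE , ⊆G-trans ⊆-addEdge D+⊆E , ⊆G-trans E⊆ (∪G-addEdge {G = D} Bij) , B≤E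
    where
    bound′ : size B ≤ k + size (addEdge D i j)
    bound′ = ≤-trans bound (≤-trans (≤-reflexive (sym (+-suc k (size D))))
                                    (+-monoʳ-≤ k (size-< ⊆-addEdge i<j Dij (addEdge-edge D i j))))

  -- If A + ij were independent, augmenting D from it would give an independent E ⊆ D ∪ A + ij with
  -- more edges than A and without ij (D + ij is dependent); augmenting A from E then adds an edge of
  -- D to A, which D ⊆ cl A forbids.
  closure-trans : {A D : Graph n} {i j : Fin n} → Ind M A → Ind M D → Spans A D → i <F j →
                  InClosure D i j → InClosure A i j
  closure-trans iA iD A↝D i<j (inj₁ Dij) = A↝D _ _ i<j Dij
  closure-trans {A} {D} {i} {j} iA iD A↝D i<j (inj₂ D+dep) with A i j in Aij
  ... | true  = inj₁ refl
  ... | false = inj₂ λ iA+ → refute (augment-until (size (addEdge A i j)) iD iA+ (m≤m+n _ _))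
    where
    refute : Σ[ E ∈ Graph n ] Ind M E × D ⊆G E × E ⊆G (D ∪G addEdge A i j) × size (addEdge A i j) ≤ size E → ⊥
    refute (E , iE , D⊆E , E⊆ , A+≤E) with E i j in Eij
    ... | true  = D+dep (ind-sub M (addEdge-⊆ D⊆E Eij) iE)
    ... | false with ind-aug M iA iE (<-≤-trans (size-< ⊆-addEdge i<j Aij (addEdge-edge A i j)) A+≤E)
    ...   | p , q , p<q , Epq , Apq , iAp with ∨-true⁻ {D p q} (E⊆ p q p<q Epq)
    ...     | inj₁ Dpq = ∉-closure Apq iAp (A↝D p q p<q Dpq)
    ...     | inj₂ A+pq with addEdge⁻ {G = A} A+pq
    ...       | inj₁ Apq′          = ≡false⇒¬≡true Apq Apq′
    ...       | inj₂ (refl , refl) = ≡false⇒¬≡true Eij Epq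

  SpansPair : Graph n → Fin n → Fin n → Set
  SpansPair A x y = (x <F y → InClosure A x y) × (y <F x → InClosure A y x)

  spansPair-sym : {A : Graph n} {x y : Fin n} → SpansPair A x y → SpansPair A y x
  spansPair-sym (x↝y , y↝x) = y↝x , x↝y

  spansPair-refl : {A : Graph n} {x : Fin n} → SpansPair A x x
  spansPair-refl = (λ x<x → contradiction x<x (<-irrefl refl)) , (λ x<x → contradiction x<x (<-irrefl refl))

  spansPair-mono : {A B : Graph n} {x y : Fin n} → A ⊆G B → SpansPair A x y → SpansPair B x y
  spansPair-mono A⊆B (x↝y , y↝x) =
    (λ x<y → InClosure-mono A⊆B x<y (x↝y x<y)) , (λ y<x → InClosure-mono A⊆B y<x (y↝x y<x))

  extend-to-edge : {A : Graph n} → Ind M A → (i j : Fin n) →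
                   ¬ ¬ (Σ[ B ∈ Graph n ] Ind M B × A ⊆G B × InClosure B i j × size B ≤ suc (size A))
  extend-to-edge {A} iA i j = do
    Ind? ← ¬¬-excluded-middle
    return (extend Ind?)
    where
    extend : Dec (Ind M (addEdge A i j)) →
             Σ[ B ∈ Graph n ] Ind M B × A ⊆G B × InClosure B i j × size B ≤ suc (size A)
    extend (yes iA+)  = addEdge A i j , iA+ , ⊆-addEdge , inj₁ (addEdge-edge A i j) , size-addEdge A i j
    extend (no A+dep) = A , iA , ⊆G-refl , inj₂ A+dep , n≤1+n (size A)

  extend-to-pair : {A : Graph n} → Ind M A → (x y : Fin n) →
                   ¬ ¬ (Σ[ B ∈ Graph n ] Ind M B × A ⊆G B × SpansPair B x y × size B ≤ suc (size A))
  extend-to-pair iA x y with <-cmp x y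
  ... | tri< x<y _ y≮x = do
    B , iB , A⊆B , x↝y , B≤ ← extend-to-edge iA x y
    return (B , iB , A⊆B , ((λ _ → x↝y) , λ y<x → contradiction y<x y≮x) , B≤)
  ... | tri≈ _ refl _ = return (_ , iA , ⊆G-refl , spansPair-refl , n≤1+n _)
  ... | tri> x≮y _ y<x = do
    B , iB , A⊆B , y↝x , B≤ ← extend-to-edge iA y x
    return (B , iB , A⊆B , ((λ x<y → contradiction x<y x≮y) , λ _ → y↝x) , B≤)

  spanning-set : (es : List (Fin n × Fin n)) →
                 ¬ ¬ (Σ[ A ∈ Graph n ] Ind M A × All (uncurry (SpansPair A)) es × size A ≤ length es)
  spanning-set [] = return (emptyG , ind-∅ M , [] , ≤-reflexive (size-emptyG {n}))
  spanning-set ((x , y) ∷ es) = do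
    A , iA , A↝es , A≤ ← spanning-set es
    B , iB , A⊆B , B↝xy , B≤ ← extend-to-pair iA x y
    return (B , iB , B↝xy ∷ All.map (spansPair-mono A⊆B) A↝es , ≤-trans B≤ (s≤s A≤))

-- Spanning complete graphs by K4 circuits

IsK4Circuit : {n : ℕ} → Matroid n → Fin n → Fin n → Fin n → Fin n → Set
IsK4Circuit M a b c d = ¬ Ind M (K4 a b c d) × Ind M (K4-minus a b c d)

K4sAreCircuits : {n : ℕ} → Matroid n → Set
K4sAreCircuits M = ∀ a b c d → a ≢ b → a ≢ c → a ≢ d → b ≢ c → b ≢ d → c ≢ d → IsK4Circuit M a b c d

rigidity⇒K4s : {n : ℕ} {M : Matroid n} → Is2RigidityMatroid M → K4sAreCircuits M
rigidity⇒K4s rig a b c d a≢b a≢c a≢d b≢c b≢d c≢d =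
  let K4-dep , proper⇒ind = Is2RigidityMatroid.K4circ rig a b c d a≢b a≢c a≢d b≢c b≢d c≢d
  in  K4-dep , proper⇒ind (K4-minus a b c d) (deleteEdge-⊆ {G = K4 a b c d}) (K4⊈K4-minus a≢b)

2*[2+m]∸3 : ∀ m → 2 * (2 + m) ∸ 3 ≡ suc (m + m)
2*[2+m]∸3 m = trans (cong (_∸ 3) (*-distribˡ-+ 2 2 m)) (cong (λ k → suc (m + k)) (+-identityʳ m))

module _ {n : ℕ} where

  members : Subset n → List (Fin n)
  members S = filterᵇ (lookup S) (allFin n)

  ∈-members : {S : Subset n} {i : Fin n} → lookup S i ≡ true → i ∈ members S
  ∈-members {S} {i} Si = ∈-filter⁺ (T? ∘ lookup S) (∈-allFin i) (subst T (sym Si) tt)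

  members-unique : (S : Subset n) → Unique (members S)
  members-unique S = Unique.filter⁺ (T? ∘ lookup S) (Unique.allFin⁺ n)

  length-members : (S : Subset n) → length (members S) ≡ ∣ S ∣
  length-members S = length-filterᵇ-tabulate S id (lookup S) (λ _ → refl)

module RigidityClosure {n : ℕ} (M : Matroid n) where

  open MatroidClosure M
  open RawMonad (¬¬-Monad {0ℓ}) using (return; _>>=_)

  spans-K4-minus : {A : Graph n} {a b c d : Fin n} → SpansPair A c d → SpansPair A c a → SpansPair A c b →
                   SpansPair A d a → SpansPair A d b → Spans A (K4-minus a b c d)
  spans-K4-minus {A} {a} {b} {c} {d} c↝d c↝a c↝b d↝a d↝b r s r<s e =
    let K4rs , ¬ab = deleteEdge⁻ {G = K4 a b c d} {a} {b} {r} {s} e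
        r∈ , s∈    = K4⁻ {a = a} {b} {c} {d} {r} {s} K4rs
    in  via-hubs r<s ¬ab r∈ s∈
    where
    hubs : ∀ {x} → x ∈ a ∷ b ∷ c ∷ d ∷ [] → SpansPair A c x × SpansPair A d x
    hubs (here refl)                         = c↝a , d↝a
    hubs (there (here refl))                 = c↝b , d↝b
    hubs (there (there (here refl)))         = spansPair-refl , spansPair-sym c↝d
    hubs (there (there (there (here refl)))) = c↝d , spansPair-refl

    via-hubs : ∀ {x y} → x <F y → isEdge a b x y ≡ false →
               x ∈ a ∷ b ∷ c ∷ d ∷ [] → y ∈ a ∷ b ∷ c ∷ d ∷ [] → InClosure A x y
    via-hubs x<y _ (there (there (here refl)))         y∈ = proj₁ (proj₁ (hubs y∈)) x<y
    via-hubs x<y _ (there (there (there (here refl)))) y∈ = proj₁ (proj₂ (hubs y∈)) x<y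
    via-hubs x<y _ x∈ (there (there (here refl)))         = proj₂ (proj₁ (hubs x∈)) x<y
    via-hubs x<y _ x∈ (there (there (there (here refl)))) = proj₂ (proj₂ (hubs x∈)) x<y
    via-hubs x<y _   (here refl)         (here refl)         = contradiction x<y (<-irrefl refl)
    via-hubs _   ¬ab (here refl)         (there (here refl)) = ⊥-elim (≡false⇒¬≡true ¬ab (isEdge-refl a b))
    via-hubs _   ¬ab (there (here refl)) (here refl)         = ⊥-elim (≡false⇒¬≡true ¬ab (isEdge-swap a b))
    via-hubs x<y _   (there (here refl)) (there (here refl)) = contradiction x<y (<-irrefl refl)

  K4-closure : {A : Graph n} {a b c d : Fin n} → Ind M A → IsK4Circuit M a b c d → a <F b →
               SpansPair A c d → SpansPair A c a → SpansPair A c b → SpansPair A d a → SpansPair A d b →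
               InClosure A a b
  K4-closure iA (K4-dep , K4⁻-ind) a<b c↝d c↝a c↝b d↝a d↝b =
    closure-trans iA K4⁻-ind (spans-K4-minus c↝d c↝a c↝b d↝a d↝b) a<b
      (inj₂ λ iK4⁻+ → K4-dep (ind-sub M (⊆-addEdge-deleteEdge a<b) iK4⁻+))

  fan : Fin n → Fin n → List (Fin n) → List (Fin n × Fin n)
  fan a b xs = (a , b) ∷ map (a ,_) xs ++ map (b ,_) xs

  length-fan : (a b : Fin n) (xs : List (Fin n)) → length (fan a b xs) ≡ 2 * length (a ∷ b ∷ xs) ∸ 3
  length-fan a b xs =
    trans (cong suc (trans (length-++ (map (a ,_) xs)) (cong₂ _+_ (length-map (a ,_) xs) (length-map (b ,_) xs))))
          (sym (2*[2+m]∸3 (length xs)))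

  spans-complete : K4sAreCircuits M → {A : Graph n} {a b : Fin n} {xs : List (Fin n)} →
                   Ind M A → Unique (a ∷ b ∷ xs) → All (uncurry (SpansPair A)) (fan a b xs) →
                   ∀ {x y} → x ∈ a ∷ b ∷ xs → y ∈ a ∷ b ∷ xs → SpansPair A x y
  spans-complete K4s {A} {a} {b} {xs} iA ((a≢b ∷ a∉xs) ∷ b∉xs ∷ _) (a↝b ∷ a↝xs++b↝xs) = spans
    where
    a↝xs : All (SpansPair A a) xs
    a↝xs = map⁻ (proj₁ (++⁻ (map (a ,_) xs) a↝xs++b↝xs))

    b↝xs : All (SpansPair A b) xs
    b↝xs = map⁻ (proj₂ (++⁻ (map (a ,_) xs) a↝xs++b↝xs))

    circuit : ∀ {x y} → x ∈ xs → y ∈ xs → x ≢ y → IsK4Circuit M x y a b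
    circuit x∈ y∈ x≢y = K4s _ _ a b x≢y (≢-sym (All.lookup a∉xs x∈)) (≢-sym (All.lookup b∉xs x∈))
                                        (≢-sym (All.lookup a∉xs y∈)) (≢-sym (All.lookup b∉xs y∈)) a≢b

    spans : ∀ {x y} → x ∈ a ∷ b ∷ xs → y ∈ a ∷ b ∷ xs → SpansPair A x y
    spans (here refl)         (here refl)         = spansPair-refl
    spans (here refl)         (there (here refl)) = a↝b
    spans (here refl)         (there (there y∈))  = All.lookup a↝xs y∈
    spans (there (here refl)) (here refl)         = spansPair-sym a↝b
    spans (there (here refl)) (there (here refl)) = spansPair-refl
    spans (there (here refl)) (there (there y∈))  = All.lookup b↝xs y∈
    spans (there (there x∈))  (here refl)         = spansPair-sym (All.lookup a↝xs x∈)
    spans (there (there x∈))  (there (here refl)) = spansPair-sym (All.lookup b↝xs x∈)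
    spans {x} {y} (there (there x∈)) (there (there y∈)) with x ≟ y
    ... | yes refl = spansPair-refl
    ... | no x≢y   =
      (λ x<y → K4-closure iA (circuit x∈ y∈ x≢y) x<y a↝b a↝x a↝y b↝x b↝y) ,
      (λ y<x → K4-closure iA (circuit y∈ x∈ (≢-sym x≢y)) y<x a↝b a↝y a↝x b↝y b↝x)
      where
      a↝x = All.lookup a↝xs x∈
      a↝y = All.lookup a↝xs y∈
      b↝x = All.lookup b↝xs x∈
      b↝y = All.lookup b↝xs y∈

  spanning-complete : K4sAreCircuits M → (xs : List (Fin n)) → Unique xs → 2 ≤ length xs →
                      ¬ ¬ (Σ[ A ∈ Graph n ] Ind M A × (∀ {x y} → x ∈ xs → y ∈ xs → SpansPair A x y) ×
                                             size A ≤ 2 * length xs ∸ 3)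
  spanning-complete K4s (a ∷ b ∷ xs) u _ = do
    A , iA , A↝fan , A≤ ← spanning-set (fan a b xs)
    return (A , iA , (λ {x} {y} → spans-complete K4s iA u A↝fan {x} {y}) ,
            ≤-trans A≤ (≤-reflexive (length-fan a b xs)))
  spanning-complete _ (_ ∷ []) _ (s≤s ())

  K4s⇒R-Ind : K4sAreCircuits M → {G : Graph n} → Ind M G → R-Ind G
  K4s⇒R-Ind K4s {G} iG S 2≤∣S∣ = decidable-stable (size (induced G S) ≤? 2 * ∣ S ∣ ∸ 3) do
    A , iA , A↝S , A≤ ← spanning-complete K4s (members S) (members-unique S)
                                              (subst (2 ≤_) (sym (length-members S)) 2≤∣S∣)
    return (≤-trans (spans-size iA (spans-induced A↝S) (ind-sub M induced-⊆ iG) ⊆G-refl)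
                    (subst (λ m → size A ≤ 2 * m ∸ 3) (length-members S) A≤))
    where
    induced-⊆ : induced G S ⊆G G
    induced-⊆ _ _ _ e = proj₁ (∧-true⁻ e)

    spans-induced : {A : Graph n} → (∀ {x y} → x ∈ members S → y ∈ members S → SpansPair A x y) →
                    Spans A (induced G S)
    spans-induced A↝S i j i<j e =
      let Si , Sj = ∧-true⁻ {lookup S i} (proj₂ (∧-true⁻ {G i j} e))
      in  proj₁ (A↝S (∈-members {S = S} Si) (∈-members {S = S} Sj)) i<j

-- Matroidal families

permutation-injective : {n : ℕ} (σ : Permutation′ n) → Injective _≡_ _≡_ (σ ⟨$⟩ʳ_)
permutation-injective σ σi≡σj = trans (sym (inverseˡ σ)) (trans (cong (σ ⟨$⟩ˡ_) σi≡σj) (inverseˡ σ))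

insert-self : {m n : ℕ} (i : Fin (suc m)) (j : Fin (suc n)) (π : Permutation m n) → insert i j π ⟨$⟩ʳ i ≡ j
insert-self i j π with i ≟ i
... | yes _  = refl
... | no i≢i = contradiction refl i≢i

extend-to-permutation : {m n : ℕ} (m≤n : m ≤ n) (x : Fin m → Fin n) → Injective _≡_ _≡_ x →
                        Σ[ σ ∈ Permutation′ n ] ∀ k → σ ⟨$⟩ʳ inject≤ k m≤n ≡ x k
extend-to-permutation {zero} _ x _ = idₚ , λ ()
extend-to-permutation {suc m} {suc n} (s≤s m≤n) x x-inj = insert 0F (x 0F) σ , σ-extends
  where
  x₀≢ : ∀ k → x 0F ≢ x (suc k)
  x₀≢ k x₀≡xₖ with () ← x-inj x₀≡xₖ

  x′ : Fin m → Fin n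
  x′ k = punchOut (x₀≢ k)

  x′-inj : Injective _≡_ _≡_ x′
  x′-inj x′ᵢ≡x′ⱼ = suc-injective (x-inj (punchOut-injective (x₀≢ _) (x₀≢ _) x′ᵢ≡x′ⱼ))

  σ : Permutation′ n
  σ = proj₁ (extend-to-permutation m≤n x′ x′-inj)

  σ-extends : ∀ k → insert 0F (x 0F) σ ⟨$⟩ʳ inject≤ k (s≤s m≤n) ≡ x k
  σ-extends 0F      = insert-self 0F (x 0F) σ
  σ-extends (suc k) = trans (insert-punchIn 0F (x 0F) σ (inject≤ k m≤n))
                            (trans (cong (punchIn (x 0F)) (proj₂ (extend-to-permutation m≤n x′ x′-inj) k))
                                   (punchIn-punchOut (x₀≢ k)))

module _ {n : ℕ} where

  quad : Fin n → Fin n → Fin n → Fin n → Fin 4 → Fin n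
  quad a b c d = lookup (a ∷ᵛ b ∷ᵛ c ∷ᵛ d ∷ᵛ []ᵛ)

  quad-injective : {a b c d : Fin n} → a ≢ b → a ≢ c → a ≢ d → b ≢ c → b ≢ d → c ≢ d →
                   Injective _≡_ _≡_ (quad a b c d)
  quad-injective a≢b a≢c a≢d b≢c b≢d c≢d =
    lookup-injective ((a≢b ∷ a≢c ∷ a≢d ∷ []) ∷ (b≢c ∷ b≢d ∷ []) ∷ (c≢d ∷ []) ∷ [] ∷ []) _ _

module _ {n : ℕ} (σ : Permutation′ n) where

  relabel-K4 : (a b c d : Fin n) → relabel σ (K4 (σ ⟨$⟩ʳ a) (σ ⟨$⟩ʳ b) (σ ⟨$⟩ʳ c) (σ ⟨$⟩ʳ d)) ≈G K4 a b c d
  relabel-K4 a b c d i j _ =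
    trans (adj-symmetric (K4-symmetric (σ ⟨$⟩ʳ a) (σ ⟨$⟩ʳ b) (σ ⟨$⟩ʳ c) (σ ⟨$⟩ʳ d)) (σ ⟨$⟩ʳ i) (σ ⟨$⟩ʳ j))
          (K4-∘ (permutation-injective σ) a b c d i j)

  relabel-K4-minus : (a b c d : Fin n) →
                     relabel σ (K4-minus (σ ⟨$⟩ʳ a) (σ ⟨$⟩ʳ b) (σ ⟨$⟩ʳ c) (σ ⟨$⟩ʳ d)) ≈G K4-minus a b c d
  relabel-K4-minus a b c d i j _ =
    trans (adj-symmetric {G = K4-minus (σ ⟨$⟩ʳ a) (σ ⟨$⟩ʳ b) (σ ⟨$⟩ʳ c) (σ ⟨$⟩ʳ d)}
                         (deleteEdge-symmetric (K4-symmetric (σ ⟨$⟩ʳ a) (σ ⟨$⟩ʳ b) (σ ⟨$⟩ʳ c) (σ ⟨$⟩ʳ d))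
                                               (σ ⟨$⟩ʳ a) (σ ⟨$⟩ʳ b))
                         (σ ⟨$⟩ʳ i) (σ ⟨$⟩ʳ j))
          (K4-minus-∘ (permutation-injective σ) a b c d i j)

module FamilyK4Circuits (F : MatroidalFamily) where

  open MatroidalFamily F

  relabel-K4-circuit : {n : ℕ} (σ : Permutation′ n) {a b c d a′ b′ c′ d′ : Fin n} →
                       σ ⟨$⟩ʳ a ≡ a′ → σ ⟨$⟩ʳ b ≡ b′ → σ ⟨$⟩ʳ c ≡ c′ → σ ⟨$⟩ʳ d ≡ d′ →
                       IsK4Circuit (M n) a b c d → IsK4Circuit (M n) a′ b′ c′ d′
  relabel-K4-circuit {n} σ {a} {b} {c} {d} refl refl refl refl (K4-dep , K4⁻-ind) =
    (λ iK4 → K4-dep (ind-ext (M n) (relabel-K4 σ a b c d) (proj₁ (relabel-inv σ _) iK4))) ,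
    proj₂ (relabel-inv σ _) (ind-ext (M n) (λ i j i<j → sym (relabel-K4-minus σ a b c d i j i<j)) K4⁻-ind)

  restrict-K4-circuit : {m n : ℕ} (m≤n : m ≤ n) {a b c d : Fin m} → IsK4Circuit (M m) a b c d →
                        IsK4Circuit (M n) (inject≤ a m≤n) (inject≤ b m≤n) (inject≤ c m≤n) (inject≤ d m≤n)
  restrict-K4-circuit {m} {n} m≤n {a} {b} {c} {d} (K4-dep , K4⁻-ind) =
    (λ iK4 → K4-dep (ind-ext (M m) (λ i j _ → K4-∘ φ-inj a b c d i j) (proj₁ (consistent m≤n _ K4-supported) iK4))) ,
    proj₂ (consistent m≤n _ K4⁻-supported) (ind-ext (M m) (λ i j _ → sym (K4-minus-∘ φ-inj a b c d i j)) K4⁻-ind)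
    where
    φ : Fin m → Fin n
    φ k = inject≤ k m≤n

    φ-inj : Injective _≡_ _≡_ φ
    φ-inj = inject≤-injective m≤n m≤n _ _

    φ-< : ∀ k → toℕ (φ k) < m
    φ-< k = subst (_< m) (sym (toℕ-inject≤ k m≤n)) (toℕ<n k)

    K4-supported : SupportedIn m (K4 (φ a) (φ b) (φ c) (φ d))
    K4-supported i j _ e with proj₂ (K4⁻ {a = φ a} {φ b} {φ c} {φ d} {i} {j} e)
    ... | here refl                         = φ-< a
    ... | there (here refl)                 = φ-< b
    ... | there (there (here refl))         = φ-< c
    ... | there (there (there (here refl))) = φ-< d

    K4⁻-supported : SupportedIn m (K4-minus (φ a) (φ b) (φ c) (φ d))
    K4⁻-supported i j i<j e =
      K4-supported i j i<j (deleteEdge-⊆ {G = K4 (φ a) (φ b) (φ c) (φ d)} {φ a} {φ b} i j i<j e)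

  -- A basis B of M 4 has five of the six edges of K₀; it contains K₀ minus its missing edge ij,
  -- and a permutation sending 0, 1 to i, j turns that graph into K4-minus 0F 1F 2F 3F.
  K4-circuit-Fin4 : HasRank (M 4) 5 → IsK4Circuit (M 4) 0F 1F 2F 3F
  K4-circuit-Fin4 ((B , iB , |B|≡5) , rank≤5) =
    (λ iK4 → 1+n≰n (rank≤5 _ iK4)) ,
    (let (i , j) , i<j , K₀ij , Bij = missing-edge {G = B} {H = K₀} (≤-reflexive (cong suc |B|≡5))
     in  relabel-to-01 (<⇒≢ i<j) (ind-sub (M 4) (size-≤⇒⊇ (B⊆K₀-minus i<j Bij) (K₀-minus≤B i<j K₀ij)) iB))
    where
    K₀ : Graph 4
    K₀ = K4 0F 1F 2F 3F

    K₀-complete : {i j : Fin 4} → i ≢ j → K₀ i j ≡ true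
    K₀-complete {i} {j} = K4⁺ (∈-allFin i) (∈-allFin j)

    B⊆K₀-minus : {i j : Fin 4} → i <F j → B i j ≡ false → B ⊆G deleteEdge K₀ i j
    B⊆K₀-minus = ⊆-deleteEdge (λ _ _ x<y _ → K₀-complete (<⇒≢ x<y))

    K₀-minus≤B : {i j : Fin 4} → i <F j → K₀ i j ≡ true → size (deleteEdge K₀ i j) ≤ size B
    K₀-minus≤B {i} {j} i<j K₀ij = subst (size (deleteEdge K₀ i j) ≤_) (sym |B|≡5)
      (s≤s⁻¹ (size-< (deleteEdge-⊆ {G = K₀}) i<j (deleteEdge-edge K₀ i j) K₀ij))

    relabel-K₀-minus : (σ : Permutation′ 4) → relabel σ (deleteEdge K₀ (σ ⟨$⟩ʳ 0F) (σ ⟨$⟩ʳ 1F)) ≈G K4-minus 0F 1F 2F 3F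
    relabel-K₀-minus σ x y x<y =
      trans (adj-symmetric {G = deleteEdge K₀ (σ ⟨$⟩ʳ 0F) (σ ⟨$⟩ʳ 1F)}
                           (deleteEdge-symmetric (K4-symmetric 0F 1F 2F 3F) (σ ⟨$⟩ʳ 0F) (σ ⟨$⟩ʳ 1F))
                           (σ ⟨$⟩ʳ x) (σ ⟨$⟩ʳ y))
            (cong₂ (λ k e → k ∧ not e)
                   (trans (K₀-complete (<⇒≢ x<y ∘ permutation-injective σ)) (sym (K₀-complete (<⇒≢ x<y))))
                   (isEdge-∘ (permutation-injective σ) 0F 1F x y))

    relabel-to-01 : {i j : Fin 4} → i ≢ j → Ind (M 4) (deleteEdge K₀ i j) → Ind (M 4) (K4-minus 0F 1F 2F 3F)
    relabel-to-01 {i} {j} i≢j iK₀-ij =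
      let σ , σ-ij = extend-to-permutation (s≤s (s≤s z≤n)) (lookup (i ∷ᵛ j ∷ᵛ []ᵛ))
                                           (lookup-injective ((i≢j ∷ []) ∷ [] ∷ []) _ _)
          iK₀-σ    = subst₂ (λ i j → Ind (M 4) (deleteEdge K₀ i j)) (sym (σ-ij 0F)) (sym (σ-ij 1F)) iK₀-ij
      in  ind-ext (M 4) (relabel-K₀-minus σ) (proj₁ (relabel-inv σ _) iK₀-σ)

  family⇒K4s : Is2RigidityFamily F → (n : ℕ) → K4sAreCircuits (M n)
  family⇒K4s R n a b c d a≢b a≢c a≢d b≢c b≢d c≢d =
    let σ , σ-quad = extend-to-permutation 4≤n (quad a b c d) quad-inj
    in  relabel-K4-circuit σ (σ-quad 0F) (σ-quad 1F) (σ-quad 2F) (σ-quad 3F)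
          (restrict-K4-circuit 4≤n (K4-circuit-Fin4 (Is2RigidityFamily.rank2 R 4 (s≤s (s≤s z≤n)))))
    where
    quad-inj = quad-injective a≢b a≢c a≢d b≢c b≢d c≢d
    4≤n = injective⇒≤ quad-inj

proposition3p1 : ((n : ℕ) → 2 ≤ n → (M : Matroid n) → Is2RigidityMatroid M →
    (G : Graph n) → Ind M G → R-Ind G)
    ×
    ((F : MatroidalFamily) → Is2RigidityFamily F →
    (n : ℕ) → 2 ≤ n → (G : Graph n) → Ind (MatroidalFamily.M F n) G → R-Ind G)
proposition3p1 =
  (λ n _ M rig G iG → RigidityClosure.K4s⇒R-Ind M (rigidity⇒K4s rig) iG) ,
  (λ F R n _ G iG → RigidityClosure.K4s⇒R-Ind (MatroidalFamily.M F n) (FamilyK4Circuits.family⇒K4s F R n) iG)
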